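{- Let $G=(V,E)$ be a connected graph and let $\chi=(\mathfrak m,\mathfrak M)$ be a monitor placement for $G$, with $\hat m=|\mathfrak m|$ and $\hat M=|\mathfrak M|$. Then, under the $\mathrm{CSP}$ routing mechanism, $\mu(G\mid\chi)<\max(\hat m,\hat M)$.
   Context: A monitor placement $\chi=(\mathfrak m,\mathfrak M)$ for a graph $G=(V,E)$ specifies a set $\mathfrak m\subseteq V$ of input nodes (nodes linked to external input monitors) and a set $\mathfrak M\subseteq V$ of output nodes (nodes linked to external output monitors). Under the routing mechanism $\mathrm{CSP}$ (controllable simple-path probing), the set of measurement paths $\mathbb P(G\mid\chi)$ consists of all simple (cycle-free, no repeated node) paths in $G$ from a node of $\mathfrak m$ to a different node of $\mathfrak M$ (in directed graphs paths follow edge directions); in particular single-node paths are not allowed. For a node $v$, $\mathbb P(v)$ is the set of paths in $\mathbb P(G\mid\chi)$ passing through $v$, and for $U\subseteq V$, $\mathbb P(U)=\bigcup_{u\in U}\mathbb P(u)$. $V$ is $k$-identifiable if for all $U,W\subseteq V$ with $U\neq W$ and $|U|,|W|\le k$ we have $\mathbb P(U)\neq\mathbb P(W)$ (i.e. $\mathbb P(U)\triangle\mathbb P(W)\neq\emptyset$). The maximal identifiability $\mu(G\mid\chi)$ is the largest $k\ge 0$ such that $V$ is $k$-identifiable with respect to $\mathbb P(G\mid\chi)$. -}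

module Defs where

open import Data.Nat using (ℕ; _≤_; _<_; _⊔_; suc; zero)
open import Data.Fin using (Fin)
open import Data.Fin.Subset using (Subset; _∈_; ∣_∣)
open import Data.List using (List; []; _∷_; _++_; [_])
open import Data.List.Membership.Propositional renaming (_∈_ to _∈ₗ_)
open import Data.List.Relation.Unary.Linked using (Linked)
open import Data.List.Relation.Unary.Unique.Propositional using (Unique)
open import Data.Product using (Σ; ∃; _×_)
open import Data.Sum using (_⊎_)
open import Relation.Binary.PropositionalEquality using (_≡_; _≢_)
open import Relation.Nullary using (¬_)
open import Function.Bundles using (_⇔_)

record Graph : Set₁ where
  field
    n      : ℕ
    E      : Fin n → Fin n → Set
    sym    : ∀ {u v} → E u v → E v u
    irrefl : ∀ {u} → ¬ E u u
open Graph public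

Connected : Graph → Set
Connected G = ∀ (u v : Fin (n G)) →
  u ≡ v ⊎ ∃ λ (mid : List (Fin (n G))) → Linked (E G) (u ∷ mid ++ [ v ])

-- Monitor placement χ = (𝔪, 𝔐): input nodes and output nodes.
record Placement (G : Graph) : Set where
  constructor placement
  field
    inputs  : Subset (n G)
    outputs : Subset (n G)
open Placement public

-- CSP measurement paths: simple paths (no repeated node) following
-- edges, from a node of 𝔪 to a (necessarily different) node of 𝔐,
-- with at least two nodes.
record MeasPath (G : Graph) (χ : Placement G) (p : List (Fin (n G))) : Set where
  field
    start   : Fin (n G)
    mid     : List (Fin (n G))
    end     : Fin (n G)
    shape   : p ≡ start ∷ mid ++ [ end ]
    linked  : Linked (E G) p
    simple  : Unique p
    start∈  : start ∈ inputs χ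
    end∈    : end ∈ outputs χ

ℙ : (G : Graph) (χ : Placement G) → Subset (n G) → List (Fin (n G)) → Set
ℙ G χ U p = MeasPath G χ p × ∃ λ u → u ∈ U × u ∈ₗ p

Identifiable : (G : Graph) (χ : Placement G) → ℕ → Set
Identifiable G χ k = ∀ (U W : Subset (n G)) → ∣ U ∣ ≤ k → ∣ W ∣ ≤ k → U ≢ W →
  ¬ (∀ p → ℙ G χ U p ⇔ ℙ G χ W p)

-- μ(G | χ) < K, where μ is the largest k with V k-identifiable:
-- every k for which V is k-identifiable is below K.
μ<_ : (G : Graph) (χ : Placement G) → ℕ → Set
μ<_ G χ K = ∀ k → Identifiable G χ k → k < K

module Submission where

-- Call a node set U a *cover* if every measurement path passes through
-- a node of U.  Any two covers U, W induce the same path sets,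
-- ℙ(U) = ℙ(W) = ℙ(G | χ), so two distinct covers of size ≤ k witness
-- that V is not k-identifiable.  It therefore suffices to exhibit two
-- distinct covers of size ≤ K = max(|𝔪|, |𝔐|) whenever K ≥ 1:
--   * 𝔪 covers (paths start in 𝔪) and 𝔐 covers (paths end in 𝔐),
--     which settles the case 𝔪 ≠ 𝔐;
--   * if 𝔪 = 𝔐 = S, then S is nonempty (as K ≥ 1); for u ∈ S the set
--     S - u still covers, because the two endpoints of a path are
--     distinct members of S, so one of them differs from u.

open import Defs
open import Data.Nat using (ℕ; _≤_; _<_; _⊔_)
open import Data.Nat.Properties using (≤-trans; <⇒≤; <-irrefl; ≰⇒>; m≤m⊔n; m≤n⊔m; ⊔-idem)
open import Data.Fin using (Fin) renaming (_≟_ to _≟ᶠ_)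
open import Data.Fin.Subset using (Subset; _∈_; _-_; ∣_∣; Nonempty)
open import Data.Fin.Subset.Properties using (x∈p∧x≢y⇒x∈p-y; x∈p⇒∣p-x∣<∣p∣; nonempty?; Empty-unique; ∣⊥∣≡0)
open import Data.Vec.Properties using (≡-dec)
open import Data.Bool.Properties using () renaming (_≟_ to _≟ᵇ_)
open import Data.List.Membership.Propositional renaming (_∈_ to _∈ₗ_)
open import Data.List.Membership.Propositional.Properties using (∈-++⁺ʳ)
open import Data.List.Relation.Unary.Any using (here; there)
open import Data.List.Relation.Unary.All using (lookup)
open import Data.List.Relation.Unary.AllPairs.Core using (_∷_)
open import Data.List.Relation.Unary.Unique.Propositional using (Unique)
open import Data.Product using (∃; _×_; _,_; proj₁; proj₂)
open import Relation.Binary.PropositionalEquality using (_≡_; _≢_; refl; trans; subst; cong) renaming (sym to ≡-sym)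
open import Relation.Nullary using (¬_; yes; no; contradiction)
open import Function.Bundles using (_⇔_; mk⇔)

nonempty-of-size : ∀ {m} {S : Subset m} → 1 ≤ ∣ S ∣ → Nonempty S
nonempty-of-size {m} {S} 1≤∣S∣ with nonempty? S
... | yes S≠∅ = S≠∅
... | no  S=∅ = contradiction 1≤0 λ ()
  where
  1≤0 : 1 ≤ 0
  1≤0 = subst (1 ≤_) (trans (cong ∣_∣ (Empty-unique S=∅)) (∣⊥∣≡0 m)) 1≤∣S∣

module _ {G : Graph} {χ : Placement G} where

  open MeasPath

  start-on-path : ∀ {p} (mp : MeasPath G χ p) → start mp ∈ₗ p
  start-on-path mp = subst (start mp ∈ₗ_) (≡-sym (shape mp)) (here refl)

  end-on-path : ∀ {p} (mp : MeasPath G χ p) → end mp ∈ₗ p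
  end-on-path mp =
    subst (end mp ∈ₗ_) (≡-sym (shape mp)) (there (∈-++⁺ʳ (mid mp) (here refl)))

  start≢end : ∀ {p} (mp : MeasPath G χ p) → start mp ≢ end mp
  start≢end mp with subst Unique (shape mp) (simple mp)
  ... | start∉rest ∷ _ = lookup start∉rest (∈-++⁺ʳ (mid mp) (here refl))

Covers : (G : Graph) (χ : Placement G) → Subset (n G) → Set
Covers G χ U = ∀ {p} → MeasPath G χ p → ∃ λ u → u ∈ U × u ∈ₗ p

module _ {G : Graph} {χ : Placement G} where

  open MeasPath

  covers-agree : ∀ {U W} → Covers G χ U → Covers G χ W →
                 ∀ p → ℙ G χ U p ⇔ ℙ G χ W p
  covers-agree U-cov W-cov p =
    mk⇔ (λ (mp , _) → mp , W-cov mp) (λ (mp , _) → mp , U-cov mp)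

  inputs-cover : Covers G χ (inputs χ)
  inputs-cover mp = start mp , start∈ mp , start-on-path mp

  outputs-cover : Covers G χ (outputs χ)
  outputs-cover mp = end mp , end∈ mp , end-on-path mp

  -- When 𝔪 = 𝔐, removing any single node u from 𝔪 leaves a cover:
  -- if the path starts at u, its end is another node of 𝔐 = 𝔪.
  punctured-cover : inputs χ ≡ outputs χ → ∀ u → Covers G χ (inputs χ - u)
  punctured-cover 𝔪≡𝔐 u mp with start mp ≟ᶠ u
  ... | no start≢u = start mp , x∈p∧x≢y⇒x∈p-y (start∈ mp) start≢u , start-on-path mp
  ... | yes refl   = end mp , end∈𝔪-u , end-on-path mp
    where
    end∈𝔪-u = x∈p∧x≢y⇒x∈p-y (subst (end mp ∈_) (≡-sym 𝔪≡𝔐) (end∈ mp))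
                             (λ end≡start → start≢end mp (≡-sym end≡start))

record CoverPair (G : Graph) (χ : Placement G) (K : ℕ) : Set where
  field
    U W      : Subset (n G)
    U-covers : Covers G χ U
    W-covers : Covers G χ W
    U≢W      : U ≢ W
    ∣U∣≤K    : ∣ U ∣ ≤ K
    ∣W∣≤K    : ∣ W ∣ ≤ K

cover-pair⇒¬identifiable : ∀ {G χ K k} → CoverPair G χ K → K ≤ k →
                           ¬ Identifiable G χ k
cover-pair⇒¬identifiable pair K≤k identifiable =
  identifiable U W (≤-trans ∣U∣≤K K≤k) (≤-trans ∣W∣≤K K≤k) U≢W
               (covers-agree U-covers W-covers)
  where open CoverPair pair

cover-pair : ∀ {G} (χ : Placement G) → let K = ∣ inputs χ ∣ ⊔ ∣ outputs χ ∣ in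
             1 ≤ K → CoverPair G χ K
cover-pair {G} χ 1≤K with ≡-dec _≟ᵇ_ (inputs χ) (outputs χ)
... | no 𝔪≢𝔐 = record
  { U-covers = inputs-cover ; W-covers = outputs-cover ; U≢W = 𝔪≢𝔐
  ; ∣U∣≤K = m≤m⊔n _ _ ; ∣W∣≤K = m≤n⊔m _ _ }
... | yes 𝔪≡𝔐 = record
  { U-covers = punctured-cover 𝔪≡𝔐 u ; W-covers = inputs-cover
  ; U≢W = λ 𝔪-u≡𝔪 → <-irrefl (cong ∣_∣ 𝔪-u≡𝔪) ∣𝔪-u∣<∣𝔪∣
  ; ∣U∣≤K = ≤-trans (<⇒≤ ∣𝔪-u∣<∣𝔪∣) (m≤m⊔n _ _) ; ∣W∣≤K = m≤m⊔n _ _ }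
  where
  K≡∣𝔪∣ : ∣ inputs χ ∣ ⊔ ∣ outputs χ ∣ ≡ ∣ inputs χ ∣
  K≡∣𝔪∣ rewrite ≡-sym 𝔪≡𝔐 = ⊔-idem _
  𝔪≠∅ : Nonempty (inputs χ)
  𝔪≠∅ = nonempty-of-size (subst (1 ≤_) K≡∣𝔪∣ 1≤K)
  u : Fin (n G)
  u = proj₁ 𝔪≠∅
  ∣𝔪-u∣<∣𝔪∣ : ∣ inputs χ - u ∣ < ∣ inputs χ ∣
  ∣𝔪-u∣<∣𝔪∣ = x∈p⇒∣p-x∣<∣p∣ (proj₂ 𝔪≠∅)

theorem1 : (G : Graph) → Connected G → (χ : Placement G) →
    1 ≤ ∣ inputs χ ∣ ⊔ ∣ outputs χ ∣ →
    μ<_ G χ (∣ inputs χ ∣ ⊔ ∣ outputs χ ∣)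
theorem1 G _ χ 1≤K k identifiable =
  ≰⇒> λ K≤k → cover-pair⇒¬identifiable (cover-pair χ 1≤K) K≤k identifiable
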